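{- For all integers $k\geq 2$, \[ f_2(k)\leq 6k(k+1)(k+2). \]
   Context: For positive integers $r,n$, an $r$-coloring of a set $A\subseteq\mathbb{N}=\{1,2,\ldots\}$ is a function $\Delta:A\to\{0,1,\ldots,r-1\}$. A tuple $(a_1,\ldots,a_k,b)$ of elements of $A$ is a monochromatic solution to an equation $G(x_1,\ldots,x_k,y)=0$ if $G(a_1,\ldots,a_k,b)=0$ and $\Delta(a_1)=\cdots=\Delta(a_k)=\Delta(b)$. For integers $r,k\geq 2$, $f_r(k)$ denotes the smallest positive integer $n$ such that every $r$-coloring of $\{1,2,\ldots,n\}$ has a monochromatic solution to $1/x_1+\cdots+1/x_k=1/y$, where $x_1,\ldots,x_k$ are not necessarily distinct. -}

module Defs where

open import Data.Nat using (ℕ; zero; suc; _≤_)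
open import Data.Fin using (Fin; toℕ)
import Data.Fin as F
open import Data.Integer using (+_)
open import Data.Rational using (ℚ; _/_; 0ℚ; _+_)
open import Data.Product using (Σ; ∃; _×_)
open import Relation.Binary.PropositionalEquality using (_≡_)

-- The set {1,...,n} is represented by Fin n, with i : Fin n standing for the
-- natural number suc (toℕ i).
val : {n : ℕ} → Fin n → ℕ
val i = suc (toℕ i)

recip : {n : ℕ} → Fin n → ℚ
recip i = + 1 / val i

sumℚ : (k : ℕ) → (Fin k → ℚ) → ℚ
sumℚ zero f = 0ℚ
sumℚ (suc k) f = f F.zero + sumℚ k (λ i → f (F.suc i))

Coloring : ℕ → ℕ → Set
Coloring r n = Fin n → Fin r

-- Δ has a monochromatic solution (a_1,...,a_k,b) of 1/x_1+...+1/x_k = 1/y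
-- (the a_i not necessarily distinct).
HasMonoSol : {r n : ℕ} → (k : ℕ) → Coloring r n → Set
HasMonoSol {r} {n} k Δ =
  Σ (Fin k → Fin n) λ a → Σ (Fin n) λ b →
    (sumℚ k (λ i → recip (a i)) ≡ recip b) × (∀ i → Δ (a i) ≡ Δ b)

Property : ℕ → ℕ → ℕ → Set
Property r k n = (Δ : Coloring r n) → HasMonoSol k Δ

IsF : ℕ → ℕ → ℕ → Set
IsF r k n = 1 ≤ n × Property r k n × (∀ m → 1 ≤ m → Property r k m → n ≤ m)

-- Writing a denominator as x = L / u turns 1/x₁ + ⋯ + 1/x_k = 1/y into the
-- linear equation u₁ + ⋯ + u_k = v between divisors of L.  For k = 2 take
-- L = 60 and u = 1, …, 5: this is Schur's theorem that every 2-colouring of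
-- {1, …, 5} has a monochromatic solution of a + b = c.  For k ≥ 3 take
-- L = 6k(k+1)(k+2) and divisors built from 2, 3, k, k+1, k+2.  Fix the colour
-- of 2 and split on whether 3 has the same colour; in both cases relations
-- such as 3 + (k−1)·1 = k+2 force the colours of further divisors one at a
-- time until some relation is monochromatic.  Since having a monochromatic
-- solution is decidable, f₂(k) exists and is at most 6k(k+1)(k+2).
{-# OPTIONS --safe #-}
module Submission where

open import Defs
open import Data.Nat using (ℕ; zero; suc; _≤_; _<_; _*_; _+_; _∸_; NonZero; z≤n; s≤s; ≢-nonZero⁻¹)
open import Data.Nat.Properties
  using (*-comm; *-identityˡ; +-assoc; +-identityʳ; +-cancelʳ-≡; *-distribʳ-+; m+[n∸m]≡n; m∸n+n≡m;
         ≤-refl; ≤-trans; <⇒≤; ≮⇒≥; ≤ᵇ⇒≤; anyUpTo?)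
open import Data.Nat.Induction using (<-rec)
open import Data.Nat.Divisibility using (divides; ∣⇒≤)
open import Data.Nat.Tactic.RingSolver using (solve-∀; solve)
open import Data.Integer as ℤ using (+_)
import Data.Integer.Properties as ℤ
open import Data.Rational as ℚ using (ℚ; _/_)
open import Data.Rational.Properties as ℚ using (fromℚᵘ-cong; toℚᵘ-injective; toℚᵘ-homo-+; toℚᵘ-fromℚᵘ; 0/n≡0)
open import Data.Rational.Unnormalised as ℚᵘ using (mkℚᵘ; *≡*)
import Data.Rational.Unnormalised.Properties as ℚᵘ
open import Data.Fin as Fin using (Fin; fromℕ<; funToFin; finToFun)
open import Data.Fin.Patterns using (0F; 1F)
open import Data.Fin.Properties as Fin using (toℕ-fromℕ<; finToFun-funToFin)
open import Data.List using (_∷_; [])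
open import Data.Product using (Σ; ∃; _×_; _,_; -,_; proj₁; proj₂)
open import Data.Empty using (⊥)
open import Function using (_∘_)
open import Relation.Nullary using (¬_; Dec; yes; no; contradiction)
open import Relation.Nullary.Decidable using (map′; _×-dec_; decidable-stable)
open import Relation.Binary.PropositionalEquality

*≡*⇒/≡ : ∀ p q c d .{{_ : NonZero c}} .{{_ : NonZero d}} → p * d ≡ q * c → + p / c ≡ + q / d
*≡*⇒/≡ p q (suc c) (suc d) pd≡qc = fromℚᵘ-cong {mkℚᵘ (+ p) c} {mkℚᵘ (+ q) d} (*≡* (begin
  + p ℤ.* + suc d  ≡⟨ ℤ.pos-* p (suc d) ⟨
  + (p * suc d)    ≡⟨ cong +_ pd≡qc ⟩
  + (q * suc c)    ≡⟨ ℤ.pos-* q (suc c) ⟩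
  + q ℤ.* + suc c  ∎))
  where open ≡-Reasoning

+-distrib-/ : ∀ p q d .{{_ : NonZero d}} → + (p + q) / d ≡ + p / d ℚ.+ + q / d
+-distrib-/ p q (suc d) = toℚᵘ-injective (begin-equality
  ℚ.toℚᵘ (+ (p + q) / suc d)                      ≃⟨ toℚᵘ-/ (+ (p + q)) ⟩
  mkℚᵘ (+ (p + q)) d                              ≃⟨ *≡* cross ⟨
  mkℚᵘ (+ p) d ℚᵘ.+ mkℚᵘ (+ q) d                  ≃⟨ ℚᵘ.+-cong (toℚᵘ-/ (+ p)) (toℚᵘ-/ (+ q)) ⟨
  ℚ.toℚᵘ (+ p / suc d) ℚᵘ.+ ℚ.toℚᵘ (+ q / suc d)  ≃⟨ toℚᵘ-homo-+ (+ p / suc d) (+ q / suc d) ⟨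
  ℚ.toℚᵘ (+ p / suc d ℚ.+ + q / suc d)            ∎)
  where
  open ℚᵘ.≤-Reasoning
  toℚᵘ-/ : ∀ i → ℚ.toℚᵘ (i / suc d) ℚᵘ.≃ mkℚᵘ i d
  toℚᵘ-/ i = toℚᵘ-fromℚᵘ (mkℚᵘ i d)
  D = + suc d
  cross : (+ p ℤ.* D ℤ.+ + q ℤ.* D) ℤ.* D ≡ + (p + q) ℤ.* (D ℤ.* D)
  cross = trans (cong (ℤ._* D) (sym (ℤ.*-distribʳ-+ D (+ p) (+ q))))
         (trans (ℤ.*-assoc (+ p ℤ.+ + q) D D) (cong (ℤ._* (D ℤ.* D)) (sym (ℤ.pos-+ p q))))

sumℚ-cong : ∀ k {f g : Fin k → ℚ} → f ≗ g → sumℚ k f ≡ sumℚ k g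
sumℚ-cong zero    f≗g = refl
sumℚ-cong (suc k) f≗g = cong₂ ℚ._+_ (f≗g Fin.zero) (sumℚ-cong k (f≗g ∘ Fin.suc))

module _ {p m n} {P : (Fin m → Fin n) → Set p} (P-resp : ∀ {f g} → f ≗ g → P f → P g)
         (P? : ∀ f → Dec (P f)) where

  allFunctions? : Dec (∀ f → P f)
  allFunctions? = map′ (λ h f → P-resp (finToFun-funToFin f) (h (funToFin f)))
                       (λ h i → h (finToFun i))
                       (Fin.all? (P? ∘ finToFun))

  anyFunction? : Dec (∃ P)
  anyFunction? = map′ (λ (i , p) → finToFun i , p)
                      (λ (f , p) → funToFin f , P-resp (sym ∘ finToFun-funToFin f) p)
                      (Fin.any? (P? ∘ finToFun))

hasMonoSol? : ∀ {r n} k (Δ : Coloring r n) → Dec (HasMonoSol k Δ)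
hasMonoSol? {n = n} k Δ = anyFunction? solvedBy-resp solvedBy?
  where
  SolvedBy : (Fin k → Fin n) → Set
  SolvedBy a = Σ (Fin n) λ b → (sumℚ k (recip ∘ a) ≡ recip b) × (∀ i → Δ (a i) ≡ Δ b)
  solvedBy? : ∀ a → Dec (SolvedBy a)
  solvedBy? a = Fin.any? λ b →
    (sumℚ k (recip ∘ a) ℚ.≟ recip b) ×-dec Fin.all? (λ i → Δ (a i) Fin.≟ Δ b)
  solvedBy-resp : ∀ {a a′} → a ≗ a′ → SolvedBy a → SolvedBy a′
  solvedBy-resp a≗a′ (b , sum≡ , mono) =
    b , trans (sumℚ-cong k (sym ∘ cong recip ∘ a≗a′)) sum≡ , λ i → trans (cong Δ (sym (a≗a′ i))) (mono i)

property? : ∀ r k n → Dec (Property r k n)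
property? r k n = allFunctions? hasMonoSol-resp (hasMonoSol? k)
  where
  hasMonoSol-resp : ∀ {Δ Δ′ : Coloring r n} → Δ ≗ Δ′ → HasMonoSol k Δ → HasMonoSol k Δ′
  hasMonoSol-resp Δ≗Δ′ (a , b , sum≡ , mono) =
    a , b , sum≡ , λ i → trans (sym (Δ≗Δ′ (a i))) (trans (mono i) (Δ≗Δ′ b))

¬property-∅ : ∀ r k → ¬ Property r k 0
¬property-∅ r k prop with prop (λ ())
... | _ , () , _

Minimal : ∀ {p} → (ℕ → Set p) → ℕ → Set p
Minimal P m = P m × (∀ {j} → j < m → ¬ P j)

least : ∀ {p} {P : ℕ → Set p} → (∀ m → Dec (P m)) → ∀ {n} → P n → ∃ λ m → Minimal P m × m ≤ n
least {P = P} P? {n} = <-rec (λ n → P n → ∃ λ m → Minimal P m × m ≤ n) step n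
  where
  step : ∀ n → (∀ {j} → j < n → P j → ∃ λ m → Minimal P m × m ≤ j) →
         P n → ∃ λ m → Minimal P m × m ≤ n
  step n below pn with anyUpTo? P? n
  ... | yes (j , j<n , pj) = let m , minimal , m≤j = below j<n pj in m , minimal , ≤-trans m≤j (<⇒≤ j<n)
  ... | no none            = n , (pn , λ j<n pj → none (_ , j<n , pj)) , ≤-refl

isF-below : ∀ {r k B} → Property r k B → ∃ λ n → IsF r k n × n ≤ B
isF-below {r} {k} propB with least (property? r k) propB
... | zero  , (prop , _)     , _   = contradiction prop (¬property-∅ r k)
... | suc n , (prop , below) , n≤B =
  suc n , (s≤s z≤n , prop , λ m _ propm → ≮⇒≥ λ m<n → below m<n propm) , n≤B

other-colour : ∀ {x c d : Fin 2} → c ≢ d → x ≢ c → x ≡ d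
other-colour {0F} {0F}      _   x≢c = contradiction refl x≢c
other-colour {1F} {1F}      _   x≢c = contradiction refl x≢c
other-colour {0F} {1F} {0F} _   _   = refl
other-colour {1F} {0F} {1F} _   _   = refl
other-colour {0F} {1F} {1F} c≢d _   = contradiction refl c≢d
other-colour {1F} {0F} {0F} c≢d _   = contradiction refl c≢d

module Dichotomy {χ χ̄ : Fin 2} (χ≢χ̄ : χ ≢ χ̄) where

  to-χ : ∀ {x} → x ≢ χ̄ → x ≡ χ
  to-χ = other-colour (χ≢χ̄ ∘ sym)

  to-χ̄ : ∀ {x} → x ≢ χ → x ≡ χ̄
  to-χ̄ = other-colour χ≢χ̄

module Reciprocals {n L : ℕ} .{{_ : NonZero L}} (L≤n : L ≤ n) where

  -- Imported locally: a second constructor _∷_ in scope would break the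
  -- `solve (k ∷ [])` calls below.
  open import Data.Vec using (Vec; []; _∷_; lookup; sum; map; replicate; _++_)
  open import Data.Vec.Properties using (map-++; sum-++)
  open import Data.Vec.Relation.Unary.All using (All; []; _∷_)
  open import Data.Vec.Relation.Unary.All.Properties using (lookup⁺; ++⁺)

  record Point (u : ℕ) : Set where
    field
      pos     : Fin n
      val*u≡L : val pos * u ≡ L
  open Point public

  divisor : ∀ {u} x → x * u ≡ L → Point u
  divisor zero          0≡L = contradiction (sym 0≡L) (≢-nonZero⁻¹ L)
  divisor {u} (suc x) x*u≡L = record
    { pos     = fromℕ< x<n
    ; val*u≡L = trans (cong (λ y → suc y * u) (toℕ-fromℕ< x<n)) x*u≡L
    }
    where
    x<n : x < n
    x<n = ≤-trans (∣⇒≤ (divides u (trans (sym x*u≡L) (*-comm (suc x) u)))) L≤n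

  recip-point : ∀ {u} (p : Point u) → recip (pos p) ≡ + u / L
  recip-point {u} p =
    *≡*⇒/≡ 1 u (val (pos p)) L (trans (*-identityˡ L) (trans (sym (val*u≡L p)) (*-comm _ u)))

  Points : ℕ → Set
  Points k = Vec (∃ Point) k

  sumℚ-recip : ∀ {k} (ps : Points k) →
               sumℚ k (λ i → recip (pos (proj₂ (lookup ps i)))) ≡ + sum (map proj₁ ps) / L
  sumℚ-recip []             = sym (0/n≡0 L)
  sumℚ-recip ((u , p) ∷ ps) =
    trans (cong₂ ℚ._+_ (recip-point p) (sumℚ-recip ps)) (sym (+-distrib-/ u _ L))

  module Coloured (Δ : Coloring 2 n) where

    colour : ∀ {u} → Point u → Fin 2
    colour p = Δ (pos p)

    monoSolution : ∀ {k z} (ps : Points k) (y : Point z) → sum (map proj₁ ps) ≡ z →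
                   All (λ p → colour (proj₂ p) ≡ colour y) ps → HasMonoSol k Δ
    monoSolution ps y Σps≡z same =
      (λ i → pos (proj₂ (lookup ps i))) , pos y ,
      trans (sumℚ-recip ps) (trans (cong (λ s → + s / L) Σps≡z) (sym (recip-point y))) ,
      lookup⁺ same

    blocks : ∀ t r s {u v w} → Point u → Point v → Point w → Points (t + (r + s))
    blocks t r s a b c = replicate t (-, a) ++ replicate r (-, b) ++ replicate s (-, c)

    sum-blocks : ∀ t r s {u v w} (a : Point u) (b : Point v) (c : Point w) →
                 sum (map proj₁ (blocks t r s a b c)) ≡ t * u + (r * v + s * w)
    sum-blocks t r s {u} {v} {w} a b c = begin
      sum (map proj₁ (blocks t r s a b c))
        ≡⟨ sum-map-++ (replicate t (-, a)) _ ⟩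
      sum (map proj₁ (replicate t (-, a))) + sum (map proj₁ (replicate r (-, b) ++ replicate s (-, c)))
        ≡⟨ cong₂ _+_ (sum-replicate t a) (sum-map-++ (replicate r (-, b)) _) ⟩
      t * u + (sum (map proj₁ (replicate r (-, b))) + sum (map proj₁ (replicate s (-, c))))
        ≡⟨ cong (_+_ (t * u)) (cong₂ _+_ (sum-replicate r b) (sum-replicate s c)) ⟩
      t * u + (r * v + s * w) ∎
      where
      open ≡-Reasoning
      sum-map-++ : ∀ {i j} (ps : Points i) (qs : Points j) →
                   sum (map proj₁ (ps ++ qs)) ≡ sum (map proj₁ ps) + sum (map proj₁ qs)
      sum-map-++ ps qs = trans (cong sum (map-++ proj₁ ps qs)) (sum-++ (map proj₁ ps))
      sum-replicate : ∀ t {u} (a : Point u) → sum (map proj₁ (replicate t (-, a))) ≡ t * u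
      sum-replicate zero        a = refl
      sum-replicate (suc t) {u} a = cong (_+_ u) (sum-replicate t a)

    blocks-mono : ∀ t r s {u v w z} (a : Point u) (b : Point v) (c : Point w) (y : Point z) →
                  t * u + (r * v + s * w) ≡ z →
                  colour a ≡ colour y → colour b ≡ colour y → colour c ≡ colour y →
                  HasMonoSol (t + (r + s)) Δ
    blocks-mono t r s a b c y weights ca cb cc =
      monoSolution (blocks t r s a b c) y (trans (sum-blocks t r s a b c) weights)
        (++⁺ (replicate⁺ t ca) (++⁺ (replicate⁺ r cb) (replicate⁺ s cc)))
      where
      replicate⁺ : ∀ t {P : ∃ Point → Set} {p} → P p → All P (replicate t p)
      replicate⁺ zero    Pp = []
      replicate⁺ (suc t) Pp = Pp ∷ replicate⁺ t Pp

    module WithoutMonoSolution {k} (noSol : ¬ HasMonoSol k Δ) where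

      -- The relation c₁·u + c₂·v + (k − c₁ − c₂)·w = z, with (c₁ + c₂)·w added
      -- to both sides so that the side condition is a semiring identity in k.
      ¬mono₃ : ∀ c₁ c₂ → c₁ + c₂ ≤ k → ∀ {u v w z e}
               (a : Point u) (b : Point v) (d : Point w) (y : Point z) →
               c₁ * u + c₂ * v + k * w ≡ z + (c₁ + c₂) * w →
               colour a ≡ e → colour b ≡ e → colour d ≡ e → colour y ≡ e → ⊥
      ¬mono₃ c₁ c₂ c≤k {u} {v} {w} {z} {e} a b d y moved ca cb cd cy =
        noSol (subst (λ k → HasMonoSol k Δ) counts
                     (blocks-mono c₁ c₂ s a b d y weights (≡y ca) (≡y cb) (≡y cd)))
        where
        c = c₁ + c₂
        s = k ∸ c
        ≡y : ∀ {x} → x ≡ e → x ≡ colour y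
        ≡y x≡e = trans x≡e (sym cy)
        counts : c₁ + (c₂ + s) ≡ k
        counts = trans (sym (+-assoc c₁ c₂ s)) (m+[n∸m]≡n c≤k)
        weights : c₁ * u + (c₂ * v + s * w) ≡ z
        weights = +-cancelʳ-≡ (c * w) _ _ (begin
          c₁ * u + (c₂ * v + s * w) + c * w   ≡⟨ regroup (c₁ * u) (c₂ * v) (s * w) (c * w) ⟩
          c₁ * u + c₂ * v + (s * w + c * w)   ≡⟨ cong (_+_ (c₁ * u + c₂ * v)) (sym (*-distribʳ-+ w s c)) ⟩
          c₁ * u + c₂ * v + (s + c) * w       ≡⟨ cong (λ t → c₁ * u + c₂ * v + t * w) (m∸n+n≡m c≤k) ⟩
          c₁ * u + c₂ * v + k * w             ≡⟨ moved ⟩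
          z + c * w                           ∎)
          where
          open ≡-Reasoning
          regroup : ∀ p q r t → p + (q + r) + t ≡ p + q + (r + t)
          regroup = solve-∀

      ¬mono₂ : ∀ c → c ≤ k → ∀ {u v z e} (a : Point u) (b : Point v) (y : Point z) →
               c * u + k * v ≡ z + c * v →
               colour a ≡ e → colour b ≡ e → colour y ≡ e → ⊥
      ¬mono₂ c c≤k a b y moved ca = ¬mono₃ 0 c c≤k a a b y moved ca ca

      ¬mono-scale : ∀ {u z e} (a : Point u) (y : Point z) → k * u ≡ z → colour a ≡ e → colour y ≡ e → ⊥
      ¬mono-scale {z = z} a y ku≡z ca = ¬mono₂ 0 z≤n a a y (trans ku≡z (sym (+-identityʳ z))) ca ca

module TwoSummands (Δ : Coloring 2 144) where

  open Reciprocals {L = 60} (≤ᵇ⇒≤ 60 144 _)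
  open Coloured Δ

  -- [w] is the point x = L / w, so that 1/x = w / L.
  [1] : Point 1
  [1] = divisor 60 refl
  [2] : Point 2
  [2] = divisor 30 refl
  [3] : Point 3
  [3] = divisor 20 refl
  [4] : Point 4
  [4] = divisor 15 refl
  [5] : Point 5
  [5] = divisor 12 refl

  ¬¬mono : ¬ ¬ HasMonoSol 2 Δ
  ¬¬mono noSol = ¬mono₂ 1 1≤2 [2] [3] [5] refl refl [3]≡χ̄ [5]≡χ̄
    where
    open WithoutMonoSolution noSol
    1≤2 : 1 ≤ 2
    1≤2 = s≤s z≤n
    χ χ̄ : Fin 2
    χ = colour [1]
    χ̄ = colour [2]
    χ≢χ̄ : χ ≢ χ̄
    χ≢χ̄ χ≡χ̄ = ¬mono-scale [1] [2] refl refl (sym χ≡χ̄)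
    open Dichotomy χ≢χ̄
    [4]≡χ : colour [4] ≡ χ
    [4]≡χ = to-χ (¬mono-scale [2] [4] refl refl)
    [3]≡χ̄ : colour [3] ≡ χ̄
    [3]≡χ̄ = to-χ̄ (λ [3]≡χ → ¬mono₂ 1 1≤2 [1] [3] [4] refl refl [3]≡χ [4]≡χ)
    [5]≡χ̄ : colour [5] ≡ χ̄
    [5]≡χ̄ = to-χ̄ (¬mono₂ 1 1≤2 [1] [4] [5] refl refl [4]≡χ)

6k[k+1][k+2]≢0 : ∀ {k} → 1 ≤ k → NonZero (6 * k * (k + 1) * (k + 2))
6k[k+1][k+2]≢0 {suc k} _ = _

module ManySummands (k : ℕ) (3≤k : 3 ≤ k) (Δ : Coloring 2 (6 * k * (k + 1) * (k + 2))) where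

  1≤k : 1 ≤ k
  1≤k = ≤-trans (s≤s z≤n) 3≤k
  2≤k : 2 ≤ k
  2≤k = ≤-trans (s≤s (s≤s z≤n)) 3≤k

  open Reciprocals {{6k[k+1][k+2]≢0 1≤k}} ≤-refl
  open Coloured Δ

  -- As above, [w] is the point with 1/x = w / L; a, b, c stand for k, k + 1, k + 2.
  [1] : Point 1
  [1] = divisor (6 * k * (k + 1) * (k + 2)) (solve (k ∷ []))
  [2] : Point 2
  [2] = divisor (3 * k * (k + 1) * (k + 2)) (solve (k ∷ []))
  [3] : Point 3
  [3] = divisor (2 * k * (k + 1) * (k + 2)) (solve (k ∷ []))
  [b] : Point (k + 1)
  [b] = divisor (6 * k * (k + 2)) (solve (k ∷ []))
  [c] : Point (k + 2)
  [c] = divisor (6 * k * (k + 1)) (solve (k ∷ []))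
  [2a] : Point (2 * k)
  [2a] = divisor (3 * (k + 1) * (k + 2)) (solve (k ∷ []))
  [3a] : Point (3 * k)
  [3a] = divisor (2 * (k + 1) * (k + 2)) (solve (k ∷ []))
  [2b] : Point (2 * (k + 1))
  [2b] = divisor (3 * k * (k + 2)) (solve (k ∷ []))
  [3b] : Point (3 * (k + 1))
  [3b] = divisor (2 * k * (k + 2)) (solve (k ∷ []))
  [6a] : Point (6 * k)
  [6a] = divisor ((k + 1) * (k + 2)) (solve (k ∷ []))
  [ab] : Point (k * (k + 1))
  [ab] = divisor (6 * (k + 2)) (solve (k ∷ []))
  [ac] : Point (k * (k + 2))
  [ac] = divisor (6 * (k + 1)) (solve (k ∷ []))
  [2ab] : Point (2 * k * (k + 1))
  [2ab] = divisor (3 * (k + 2)) (solve (k ∷ []))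
  [2ac] : Point (2 * k * (k + 2))
  [2ac] = divisor (3 * (k + 1)) (solve (k ∷ []))
  [3ab] : Point (3 * k * (k + 1))
  [3ab] = divisor (2 * (k + 2)) (solve (k ∷ []))

  module _ (noSol : ¬ HasMonoSol k Δ) where

    open WithoutMonoSolution noSol

    [3]≢[2] : colour [3] ≢ colour [2]
    [3]≢[2] [3]≡χ = ¬mono₂ 1 1≤k [6a] [3a] [3ab] (solve (k ∷ [])) [6a]≡χ̄ refl [3ab]≡χ̄
      where
      χ χ̄ : Fin 2
      χ = colour [2]
      χ̄ = colour [3a]
      χ≢χ̄ : χ ≢ χ̄
      χ≢χ̄ χ≡χ̄ = ¬mono-scale [3] [3a] (solve (k ∷ [])) [3]≡χ (sym χ≡χ̄)
      open Dichotomy χ≢χ̄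
      [2a]≡χ̄ : colour [2a] ≡ χ̄
      [2a]≡χ̄ = to-χ̄ (¬mono-scale [2] [2a] (solve (k ∷ [])) refl)
      [2ab]≡χ : colour [2ab] ≡ χ
      [2ab]≡χ = to-χ (¬mono₂ 2 2≤k [3a] [2a] [2ab] (solve (k ∷ [])) refl [2a]≡χ̄)
      [2ac]≡χ̄ : colour [2ac] ≡ χ̄
      [2ac]≡χ̄ = to-χ̄ (¬mono₃ 2 1 3≤k [3] [2ab] [2] [2ac] (solve (k ∷ [])) [3]≡χ [2ab]≡χ refl)
      [2b]≡χ̄ : colour [2b] ≡ χ̄
      [2b]≡χ̄ = to-χ̄ (¬mono₂ 2 2≤k [3] [2] [2b] (solve (k ∷ [])) [3]≡χ refl)
      [3b]≡χ : colour [3b] ≡ χ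
      [3b]≡χ = to-χ (λ e → ¬mono₃ 2 1 3≤k [3b] [2a] [2b] [2ac] (solve (k ∷ [])) e [2a]≡χ̄ [2b]≡χ̄ [2ac]≡χ̄)
      [3ab]≡χ̄ : colour [3ab] ≡ χ̄
      [3ab]≡χ̄ = to-χ̄ (¬mono-scale [3b] [3ab] (solve (k ∷ [])) [3b]≡χ)
      [6a]≡χ̄ : colour [6a] ≡ χ̄
      [6a]≡χ̄ = to-χ̄ (¬mono₂ 1 1≤k [3b] [3] [6a] (solve (k ∷ [])) [3b]≡χ [3]≡χ)

    ¬[3]≢[2] : ¬ colour [3] ≢ colour [2]
    ¬[3]≢[2] [3]≢χ =
      ¬mono₃ 1 1 2≤k [ab] [2] [1] [ac] (solve (k ∷ [])) [ab]≡χ refl [1]≡χ [ac]≡χ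
      where
      χ χ̄ : Fin 2
      χ = colour [2]
      χ̄ = colour [3]
      open Dichotomy ([3]≢χ ∘ sym)
      [2a]≡χ̄ : colour [2a] ≡ χ̄
      [2a]≡χ̄ = to-χ̄ (¬mono-scale [2] [2a] (solve (k ∷ [])) refl)
      [3a]≡χ : colour [3a] ≡ χ
      [3a]≡χ = to-χ (¬mono-scale [3] [3a] (solve (k ∷ [])) refl)
      [c]≡χ̄ : colour [c] ≡ χ̄
      [c]≡χ̄ = to-χ̄ (λ e → ¬mono₂ 1 1≤k [c] [2] [3a] (solve (k ∷ [])) e refl [3a]≡χ)
      [1]≡χ : colour [1] ≡ χ
      [1]≡χ = to-χ (λ e → ¬mono₂ 1 1≤k [3] [1] [c] (solve (k ∷ [])) refl e [c]≡χ̄)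
      [b]≡χ̄ : colour [b] ≡ χ̄
      [b]≡χ̄ = to-χ̄ (¬mono₂ 1 1≤k [2] [1] [b] (solve (k ∷ [])) refl [1]≡χ)
      [ac]≡χ : colour [ac] ≡ χ
      [ac]≡χ = to-χ (¬mono₃ 1 1 2≤k [c] [2a] [b] [ac] (solve (k ∷ [])) [c]≡χ̄ [2a]≡χ̄ [b]≡χ̄)
      [ab]≡χ : colour [ab] ≡ χ
      [ab]≡χ = to-χ (¬mono₃ 1 1 2≤k [b] [3] [c] [ab] (solve (k ∷ [])) [b]≡χ̄ refl [c]≡χ̄)

  ¬¬mono : ¬ ¬ HasMonoSol k Δ
  ¬¬mono noSol = ¬[3]≢[2] noSol ([3]≢[2] noSol)

property : ∀ k → 2 ≤ k → Property 2 k (6 * k * (k + 1) * (k + 2))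
property 1                     (s≤s ())
property 2                     _ Δ = decidable-stable (hasMonoSol? 2 Δ) (TwoSummands.¬¬mono Δ)
property k@(suc (suc (suc _))) _ Δ =
  decidable-stable (hasMonoSol? k Δ) (ManySummands.¬¬mono k (s≤s (s≤s (s≤s z≤n))) Δ)

theorem1p2 : (k : ℕ) → 2 ≤ k → ∃ λ n → IsF 2 k n × n ≤ 6 * k * (k + 1) * (k + 2)
theorem1p2 k 2≤k = isF-below (property k 2≤k)
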